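{- For $\lambda\vdash 2n$, the $H_n^B(0)$-module $\mathbb C\mathsf{SDT}(\lambda)$ satisfies $\mathrm{ch}^B(\mathbb C\mathsf{SDT}(\lambda))=G_\lambda$, where $G_\lambda=\sum_{T\in\mathsf{SDT}(\lambda)}F^B_{\mathrm{Des}(T)}$.
   Context: $H_n^B(0)$ is the $\mathbb C$-algebra generated by $\pi_0,\dots,\pi_{n-1}$ with relations $\pi_i^2=-\pi_i$, $\pi_i\pi_j=\pi_j\pi_i$ for $|i-j|\ge 2$, $\pi_i\pi_{i+1}\pi_i=\pi_{i+1}\pi_i\pi_{i+1}$ for $1\le i\le n-2$, and $\pi_0\pi_1\pi_0\pi_1=\pi_1\pi_0\pi_1\pi_0$. A standard domino tableau of shape $\lambda$ is a bijective filling with $[n]$ of the dominoes of a tiling of the Young diagram of $\lambda$ by $1\times2$ and $2\times1$ dominoes, with entries increasing left to right along rows and top to bottom in columns; $\mathsf{SDT}(\lambda)$ is their set. $\mathrm{dom}_i(T)$ is the domino with entry $i$. $i\in[0,n-1]$ is a descent of $T$ if $i=0$ and $\mathrm{dom}_1(T)$ is vertical, or $i>0$ and $\mathrm{dom}_{i+1}(T)$ is strictly lower than $\mathrm{dom}_i(T)$ (in rows strictly below all rows of $\mathrm{dom}_i(T)$); $\mathrm{Des}(T)$ is the descent set. For $1\le i\le n-1$, $s_i(T)$ exchanges entries $i,i+1$; if $\mathrm{dom}_1(T),\mathrm{dom}_2(T)$ tile the northwest-most $2\times 2$ square, $s_0(T)$ switches the orientation of both (placing $1$ left of $2$ if $1$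 was above $2$, and $1$ above $2$ if $1$ was left of $2$), otherwise $s_0(T)$ is regarded as not in $\mathsf{SDT}(\lambda)$. The module structure on $\mathbb C\mathsf{SDT}(\lambda)$: $\pi_i(T)=-T$ if $i\in\mathrm{Des}(T)$, $\pi_i(T)=s_i(T)$ if $i\notin\mathrm{Des}(T)$ and $s_i(T)\in\mathsf{SDT}(\lambda)$, and $\pi_i(T)=0$ otherwise. For $I\subseteq[0,n-1]$, $\mathcal S_I^B=\mathbb C\varepsilon_I$ is the one-dimensional module with $\pi_j\varepsilon_I=-\varepsilon_I$ if $j\in I$ and $0$ otherwise. $F^B_I=\sum x_{i_1}\cdots x_{i_n}$ over integers $0=i_0\le i_1\le\cdots\le i_n$ with $i_j<i_{j+1}$ whenever $j\in I$. $\mathrm{ch}^B$ is the additive map from the Grothendieck group of finite-dimensional $H_n^B(0)$-modules (relations from short exact sequences) with $\mathrm{ch}^B([\mathcal S_I^B])=F^B_I$. -}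

module Defs where

open import Level using (Level; _⊔_) renaming (suc to lsuc)
open import Algebra.Bundles using (CommutativeRing)
open import Algebra.Module.Bundles using (Module)
import Algebra.Module.Construct.Zero as ZeroM
import Algebra.Module.Construct.TensorUnit as UnitM
import Algebra.Module.Construct.DirectProduct as ProdM
import Algebra.Properties.Group as GroupProps
import Algebra.Properties.AbelianGroup as AbGroupProps
import Algebra.Properties.Ring as RingProps
open import Data.Bool using (Bool; true; false; if_then_else_; _∧_; _∨_; not)
import Data.Nat as Nat
open import Data.Nat using (ℕ; zero; suc; _≤_; _≡ᵇ_; _<ᵇ_; _≤ᵇ_; ∣_-_∣)
open import Data.Fin using (Fin; zero; suc; toℕ; inject₁)
open import Data.Fin.Subset using (Subset)
open import Data.Vec using (Vec; []; _∷_; lookup; tabulate; _[_]≔_)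
open import Data.List using (List; []; _∷_; _++_; map; length; filterᵇ; allFin; concatMap; upTo)
open import Data.Bool.ListAction using (all; any)
open import Data.Nat.ListAction using (sum)
import Data.List as L
open import Data.List.Relation.Unary.All using (All)
open import Data.List.Relation.Unary.Linked using (Linked)
open import Data.Maybe using (Maybe; just; nothing)
open import Data.Product using (Σ; _×_; _,_; proj₁; proj₂)
open import Data.Unit.Polymorphic using (tt)
open import Relation.Binary.PropositionalEquality using (_≡_)
open import Relation.Nullary using (¬_)

record Field (c ℓ : Level) : Set (lsuc (c ⊔ ℓ)) where
  field
    commutativeRing : CommutativeRing c ℓ
  open CommutativeRing commutativeRing public
  field
    0≉1     : ¬ (0# ≈ 1#)
    inverse : ∀ x → ¬ (x ≈ 0#) → Σ Carrier (λ y → (x * y) ≈ 1#)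

IsPartition : List ℕ → Set
IsPartition la = Linked (λ a b → b ≤ a) la × All (λ p → 1 ≤ p) la

-- Modules over the 0-Hecke algebra H_n^B(0) over a field K.
-- The generators π_0,…,π_{n-1} are indexed by Fin n.

module _ {c ℓ : Level} (K : Field c ℓ) where
  open Field K using (commutativeRing)

  record IsHAction (n : ℕ) (M : Module commutativeRing c ℓ)
                   (π : Fin n → Module.Carrierᴹ M → Module.Carrierᴹ M)
                   : Set (c ⊔ ℓ) where
    open Module M
    field
      π-cong  : ∀ i {u v} → u ≈ᴹ v → π i u ≈ᴹ π i v
      π-+     : ∀ i u v → π i (u +ᴹ v) ≈ᴹ (π i u +ᴹ π i v)
      π-*     : ∀ i a v → π i (a *ₗ v) ≈ᴹ (a *ₗ π i v)
      π-quad  : ∀ i v → π i (π i v) ≈ᴹ (-ᴹ π i v)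
      π-comm  : ∀ i j → 2 ≤ ∣ toℕ i - toℕ j ∣ → ∀ v → π i (π j v) ≈ᴹ π j (π i v)
      π-braid : ∀ i j → 1 ≤ toℕ i → toℕ j ≡ suc (toℕ i) → ∀ v →
                π i (π j (π i v)) ≈ᴹ π j (π i (π j v))
      π-braidB : ∀ i j → toℕ i ≡ 0 → toℕ j ≡ 1 → ∀ v →
                 π i (π j (π i (π j v))) ≈ᴹ π j (π i (π j (π i v)))

  record HMod (n : ℕ) : Set (lsuc (c ⊔ ℓ)) where
    field
      M   : Module commutativeRing c ℓ
      π   : Fin n → Module.Carrierᴹ M → Module.Carrierᴹ M
      isH : IsHAction n M π
    open Module M public

  record IsHHom {n : ℕ} (A B : HMod n) (f : HMod.Carrierᴹ A → HMod.Carrierᴹ B)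
                : Set (c ⊔ ℓ) where
    private
      module A = HMod A
      module B = HMod B
    field
      f-cong  : ∀ {u v} → u A.≈ᴹ v → f u B.≈ᴹ f v
      f-+     : ∀ u v → f (u A.+ᴹ v) B.≈ᴹ (f u B.+ᴹ f v)
      f-*     : ∀ a v → f (a A.*ₗ v) B.≈ᴹ (a B.*ₗ f v)
      f-equiv : ∀ i v → f (A.π i v) B.≈ᴹ B.π i (f v)

  record SES {n : ℕ} (A M B : HMod n) : Set (c ⊔ ℓ) where
    private
      module A = HMod A
      module M = HMod M
      module B = HMod B
    field
      f      : A.Carrierᴹ → M.Carrierᴹ
      g      : M.Carrierᴹ → B.Carrierᴹ
      f-hom  : IsHHom A M f
      g-hom  : IsHHom M B g
      f-inj  : ∀ u v → f u M.≈ᴹ f v → u A.≈ᴹ v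
      g-surj : ∀ y → Σ M.Carrierᴹ (λ x → g x B.≈ᴹ y)
      gf≈0   : ∀ a → g (f a) B.≈ᴹ B.0ᴹ
      ker⊆im : ∀ m → g m B.≈ᴹ B.0ᴹ → Σ A.Carrierᴹ (λ a → f a M.≈ᴹ m)

  private
    open CommutativeRing commutativeRing
      using (Carrier; _≈_; _+_; _*_; 0#; -_; refl; sym; -‿cong; +-identityˡ; zeroʳ; +-group; +-abelianGroup; ring)
    module GP = GroupProps +-group
    module AP = AbGroupProps +-abelianGroup
    module RP = RingProps ring

    act : Bool → Carrier → Carrier
    act true  x = - x
    act false x = 0#

    -0≈0 : (- 0#) ≈ 0#
    -0≈0 = GP.ε⁻¹≈ε

    act-cong : ∀ b {x y} → x ≈ y → act b x ≈ act b y
    act-cong true  p = -‿cong p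
    act-cong false p = refl

    act-+ : ∀ b x y → act b (x + y) ≈ (act b x + act b y)
    act-+ true  x y = sym (AP.⁻¹-∙-comm x y)
    act-+ false x y = sym (+-identityˡ 0#)

    act-* : ∀ b a x → act b (a * x) ≈ (a * act b x)
    act-* true  a x = RP.-‿distribʳ-* a x
    act-* false a x = sym (zeroʳ a)

    act-quad : ∀ b x → act b (act b x) ≈ (- act b x)
    act-quad true  x = refl
    act-quad false x = sym -0≈0

    act-comm : ∀ b b' x → act b (act b' x) ≈ act b' (act b x)
    act-comm true  true  x = refl
    act-comm true  false x = -0≈0
    act-comm false true  x = sym -0≈0
    act-comm false false x = refl

    act-braid : ∀ b b' x → act b (act b' (act b x)) ≈ act b' (act b (act b' x))
    act-braid true  true  x = refl
    act-braid true  false x = -0≈0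
    act-braid false true  x = sym -0≈0
    act-braid false false x = refl

    act-braidB : ∀ b b' x →
      act b (act b' (act b (act b' x))) ≈ act b' (act b (act b' (act b x)))
    act-braidB true  true  x = refl
    act-braidB true  false x = -0≈0
    act-braidB false true  x = sym -0≈0
    act-braidB false false x = refl

  S : {n : ℕ} → Subset n → HMod n
  S {n} I = record
    { M   = UnitM.⟨module⟩ {R = commutativeRing}
    ; π   = λ j → act (lookup I j)
    ; isH = record
      { π-cong   = λ i → act-cong (lookup I i)
      ; π-+      = λ i → act-+ (lookup I i)
      ; π-*      = λ i → act-* (lookup I i)
      ; π-quad   = λ i → act-quad (lookup I i)
      ; π-comm   = λ i j _ → act-comm (lookup I i) (lookup I j)
      ; π-braid  = λ i j _ _ → act-braid (lookup I i) (lookup I j)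
      ; π-braidB = λ i j _ _ → act-braidB (lookup I i) (lookup I j)
      }
    }

  -- HasClass M cl : a derivation, using only short exact sequences,
  -- that in the Grothendieck group  [M] = Σ_{I ∈ cl} [S_I^B].
  data HasClass {n : ℕ} : HMod n → List (Subset n) → Set (lsuc (c ⊔ ℓ)) where
    simple : ∀ I → HasClass (S I) (I ∷ [])
    trivial : ∀ M → (∀ v → HMod._≈ᴹ_ M v (HMod.0ᴹ M)) → HasClass M []
    ext    : ∀ {A M B a b} → SES A M B → HasClass A a → HasClass B b →
             HasClass M (a ++ b)

-- Quasisymmetric functions F^B_I, represented by coefficients.
-- A sequence s = (i_1,…,i_n) stands for the monomial x_{i_1}⋯x_{i_n};
-- F^B_I = Σ x_{i_1}⋯x_{i_n} over 0 = i_0 ≤ i_1 ≤ ⋯ ≤ i_n with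
-- i_j < i_{j+1} whenever j ∈ I.  FB I s ∈ {0,1} is the coefficient of
-- the term indexed by s (0 if s is not admissible).  Since distinct weakly
-- increasing sequences give distinct monomials, two ℕ-combinations of
-- the F^B_I are equal iff their FB-coefficients agree on every s.

FB : {n : ℕ} → Subset n → Vec ℕ n → ℕ
FB {n} I s = if all ok (allFin n) then 1 else 0
  where
    prev : Fin n → ℕ
    prev zero    = 0
    prev (suc k) = lookup s (inject₁ k)
    ok : Fin n → Bool
    ok j = if lookup I j then prev j <ᵇ lookup s j else prev j ≤ᵇ lookup s j

-- ch^B applied to  Σ_{I ∈ cl} [S_I^B]
chB : {n : ℕ} → List (Subset n) → Vec ℕ n → ℕ
chB cl s = sum (map (λ I → FB I s) cl)

-- A domino (r , c , v) has top-left cell (r , c) (row r, column c, both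
-- 0-based, rows numbered top to bottom) and is vertical iff v = true:
-- it occupies (r,c),(r+1,c) if vertical, (r,c),(r,c+1) if horizontal.
-- For λ ⊢ 2n all cells have row, column < 2n, so Fin (2n) coordinates
-- lose nothing.  A filling T : Vec (Domino (2n)) n lists dom_1(T),…,dom_n(T)
-- (entry k+1 is in the domino at index k).

Domino : ℕ → Set
Domino m = Fin m × Fin m × Bool

Cell : Set
Cell = ℕ × ℕ

Filling : ℕ → Set
Filling n = Vec (Domino (2 Nat.* n)) n

cells : {m : ℕ} → Domino m → List Cell
cells (r , c , true)  = (toℕ r , toℕ c) ∷ (suc (toℕ r) , toℕ c) ∷ []
cells (r , c , false) = (toℕ r , toℕ c) ∷ (toℕ r , suc (toℕ c)) ∷ []

cellEq : Cell → Cell → Bool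
cellEq (a , b) (a' , b') = (a ≡ᵇ a') ∧ (b ≡ᵇ b')

member : Cell → List Cell → Bool
member p xs = any (cellEq p) xs

distinct : List Cell → Bool
distinct []       = true
distinct (x ∷ xs) = not (member x xs) ∧ distinct xs

part : List ℕ → ℕ → ℕ
part []        r       = 0
part (p ∷ la)  zero    = p
part (p ∷ la)  (suc r) = part la r

diagram : List ℕ → List Cell
diagram la = concatMap (λ r → map (λ c → (r , c)) (upTo (part la r))) (upTo (length la))

allCells : {n : ℕ} → Filling n → List Cell
allCells T = concatMap cells (Data.Vec.toList T)
  where import Data.Vec

nextTo : Cell → Cell → Bool
nextTo (a , b) (a' , b') = ((a ≡ᵇ a') ∧ (suc b ≡ᵇ b')) ∨ ((b ≡ᵇ b') ∧ (suc a ≡ᵇ a'))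

isSDT : {n : ℕ} → List ℕ → Filling n → Bool
isSDT {n} la T =
  distinct (allCells T)
  ∧ all (λ p → member p (diagram la)) (allCells T)
  ∧ all (λ p → member p (allCells T)) (diagram la)
  ∧ all (λ a → all (λ b → incr a b) (allFin n)) (allFin n)
  where
    incr : Fin n → Fin n → Bool
    incr a b = not (any (λ p → any (λ q → nextTo p q) (cells (lookup T b))) (cells (lookup T a)))
               ∨ (toℕ a ≤ᵇ toℕ b)

allDominoes : (m : ℕ) → List (Domino m)
allDominoes m = concatMap (λ r → concatMap (λ c → (r , c , false) ∷ (r , c , true) ∷ []) (allFin m)) (allFin m)

allVecs : {A : Set} → List A → (k : ℕ) → List (Vec A k)
allVecs xs zero    = [] ∷ []
allVecs xs (suc k) = concatMap (λ x → map (x ∷_) (allVecs xs k)) xs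

SDT : (n : ℕ) → List ℕ → List (Filling n)
SDT n la = filterᵇ (isSDT la) (allVecs (allDominoes (2 Nat.* n)) n)

bottomRow : {m : ℕ} → Domino m → ℕ
bottomRow (r , c , v) = if v then suc (toℕ r) else toℕ r

isDes : {n : ℕ} → Filling n → Fin n → Bool
isDes T zero    = proj₂ (proj₂ (lookup T zero))
isDes T (suc k) = bottomRow (lookup T (inject₁ k)) <ᵇ toℕ (proj₁ (lookup T (suc k)))
  -- dom_{i+1} lies in rows strictly below all rows of dom_i  (i = k+1)

Des : {n : ℕ} → Filling n → Subset n
Des T = tabulate (isDes T)

G : (n : ℕ) → List ℕ → Vec ℕ n → ℕ
G n la s = sum (map (λ T → FB (Des T) s) (SDT n la))

-- The operators s_i on fillings (nothing = "not a filling").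

domEq : {m : ℕ} → Domino m → Domino m → Bool
domEq (r , c , v) (r' , c' , v') = (toℕ r ≡ᵇ toℕ r') ∧ (toℕ c ≡ᵇ toℕ c') ∧ (if v then v' else not v')

fillEq : {m k : ℕ} → Vec (Domino m) k → Vec (Domino m) k → Bool
fillEq []       []       = true
fillEq (d ∷ ds) (e ∷ es) = domEq d e ∧ fillEq ds es

s0 : {m k : ℕ} → Vec (Domino m) k → Maybe (Vec (Domino m) k)
s0 ((r1 , c1 , false) ∷ (r2 , c2 , false) ∷ ds) =
  if (toℕ r1 ≡ᵇ 0) ∧ (toℕ c1 ≡ᵇ 0) ∧ (toℕ r2 ≡ᵇ 1) ∧ (toℕ c2 ≡ᵇ 0)
  then just ((r1 , c1 , true) ∷ (c2 , r2 , true) ∷ ds)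
  else nothing
s0 ((r1 , c1 , true) ∷ (r2 , c2 , true) ∷ ds) =
  if (toℕ r1 ≡ᵇ 0) ∧ (toℕ c1 ≡ᵇ 0) ∧ (toℕ r2 ≡ᵇ 0) ∧ (toℕ c2 ≡ᵇ 1)
  then just ((r1 , c1 , false) ∷ (c2 , r2 , false) ∷ ds)
  else nothing
s0 _ = nothing

sOp : {n : ℕ} → Fin n → Filling n → Maybe (Filling n)
sOp zero    T = s0 T
sOp (suc k) T = just ((T [ inject₁ k ]≔ lookup T (suc k)) [ suc k ]≔ lookup T (inject₁ k))

-- The H_n^B(0)-module  K SDT(λ).
-- Underlying space: K^N with N = |SDT(λ)|, realised as K × (K × ⋯ × ⊤);
-- coordinate j is the coefficient of the j-th tableau of SDT n λ.

module _ {c ℓ : Level} (K : Field c ℓ) where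
  open Field K using (commutativeRing; Carrier; _+_; _*_; 0#; 1#; -_)

  Kpow : ℕ → Module commutativeRing c ℓ
  Kpow zero    = ZeroM.⟨module⟩ {c} {ℓ} {R = commutativeRing}
  Kpow (suc N) = ProdM.⟨module⟩ (UnitM.⟨module⟩ {R = commutativeRing}) (Kpow N)

  coord : {N : ℕ} → Fin N → Module.Carrierᴹ (Kpow N) → Carrier
  coord {suc N} zero    (x , v) = x
  coord {suc N} (suc k) (x , v) = coord k v

  build : {N : ℕ} → (Fin N → Carrier) → Module.Carrierᴹ (Kpow N)
  build {zero}  f = tt
  build {suc N} f = f zero , build (λ k → f (suc k))

  sumK : {N : ℕ} → (Fin N → Carrier) → Carrier
  sumK {zero}  f = 0#
  sumK {suc N} f = f zero + sumK (λ k → f (suc k))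

  module _ (n : ℕ) (la : List ℕ) where
    N : ℕ
    N = length (SDT n la)

    tab : Fin N → Filling n
    tab = L.lookup (SDT n la)

    -- coefficient of tab j in π_i(tab k):
    --  π_i(T) = -T if i ∈ Des(T);  s_i(T) if i ∉ Des(T) and s_i(T) ∈ SDT(λ);  0 otherwise
    entry : Fin n → Fin N → Fin N → Carrier
    entry i j k with isDes (tab k) i | sOp i (tab k)
    ... | true  | _       = if toℕ j ≡ᵇ toℕ k then - 1# else 0#
    ... | false | just T' = if fillEq T' (tab j) then 1# else 0#
    ... | false | nothing = 0#

    CSDTspace : Module commutativeRing c ℓ
    CSDTspace = Kpow N

    CSDTact : Fin n → Module.Carrierᴹ CSDTspace → Module.Carrierᴹ CSDTspace
    CSDTact i v = build (λ j → sumK (λ k → entry i j k * coord k v))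

    CSDT : IsHAction K n CSDTspace CSDTact → HMod K n
    CSDT h = record { M = CSDTspace ; π = CSDTact ; isH = h }

module Submission where

-- Rank a standard domino tableau by the weighted sum of the rows of its dominoes (the
-- domino with entry j weighted by j) plus 2 for each vertical domino.  Whenever
-- π_i T = s_i(T) ≠ T the rank strictly increases, so in the basis SDT(λ) every π_i is
-- triangular, with diagonal entry −1 if i ∈ Des(T) and 0 otherwise.  For a tableau T of
-- minimal rank the span of the other tableaux is therefore a submodule with quotient
-- S^B_{Des(T)}; induction on the number of tableaux gives [ℂSDT(λ)] = Σ_T [S^B_{Des(T)}],
-- and applying ch^B yields G_λ.

open import Defs
open import Level using (Level)
open import Data.Nat using (ℕ; zero; suc; _≤_; _<_; _≡ᵇ_; _<ᵇ_; s≤s; z≤n; _≤?_)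
import Data.Nat as ℕ
import Data.Nat.Properties as ℕ
open import Data.Nat.ListAction using (sum)
import Data.Nat.ListAction.Properties as ℕListAction
open import Data.Nat.Tactic.RingSolver using (solve-∀)
open import Data.List using (List; []; _∷_; _++_; map; allFin; upTo; length)
import Data.List as List
import Data.List.Properties as List
import Data.List.Extrema
open import Data.List.Relation.Unary.All as All using (All)
open import Data.List.Relation.Unary.All.Properties using (all⁺)
open import Data.List.Relation.Unary.Any as Any using (Any; here; there)
open import Data.List.Relation.Unary.Any.Properties using (any⁺; any⁻)
open import Data.List.Membership.Propositional using (_∈_; find; lose)
open import Data.List.Membership.Propositional.Properties
  using (∈-allFin; ∈-concatMap⁺; ∈-concatMap⁻; ∈-map⁺; ∈-map⁻; ∈-upTo⁺; ∈-upTo⁻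
        ; ∈-filter⁻; ∈-lookup)
open import Data.Vec using (Vec; []; _∷_; lookup; _[_]≔_)
import Data.Vec as Vec
import Data.Vec.Membership.Propositional as Vec
import Data.Vec.Membership.Propositional.Properties as Vec
import Data.Vec.Relation.Unary.Any as VecAny
import Data.Vec.Relation.Unary.Any.Properties as VecAny
open import Data.Vec.Properties using (lookup∘tabulate)
open import Data.Fin using (Fin; zero; suc; toℕ; inject₁; punchIn; punchOut; _≟_)
open import Data.Fin.Properties using (toℕ-injective; toℕ-inject₁; punchIn-injective; punchInᵢ≢i; punchIn-punchOut)
open import Data.Fin.Subset using (Subset)
open import Data.Bool using (Bool; true; false; T; T?; not; _∧_; if_then_else_)
open import Data.Bool.ListAction using (all)
open import Data.Bool.Properties using (T-∧; T-∨; T-≡; T-not-≡)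
open import Data.Maybe using (just; nothing)
open import Data.Product using (Σ; _×_; _,_; proj₁; proj₂)
open import Data.Sum using (inj₁; inj₂)
open import Data.Empty using (⊥; ⊥-elim)
open import Data.Unit.Polymorphic using (tt)
open import Function using (_∘_; Equivalence)
open import Relation.Nullary using (yes; no)
open import Relation.Binary using (tri<; tri≈; tri>)
open import Relation.Binary.PropositionalEquality as ≡ using (_≡_; _≢_)
open import Algebra.Module.Bundles using (Module)
import Algebra.Properties.Ring as RingProperties
import Algebra.Properties.CommutativeMonoid.Sum as CommutativeMonoidSum
open import Algebra.Properties.CommutativeSemigroup ℕ.+-commutativeSemigroup using (x∙yz≈y∙xz)
import Relation.Binary.Reasoning.Setoid as SetoidReasoning

module ℕΣ = CommutativeMonoidSum ℕ.+-0-commutativeMonoid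

argmin-Fin : ∀ {N} (ρ : Fin (suc N) → ℕ) → Σ (Fin (suc N)) λ k₀ → ∀ k → ρ k₀ ≤ ρ k
argmin-Fin ρ = argmin ρ zero (allFin _) , λ k → All.lookup (f[argmin]≤f[xs] {f = ρ} zero (allFin _)) (∈-allFin k)
  where open Data.List.Extrema ℕ.≤-totalOrder

sum-map≡Σ-lookup : ∀ {A : Set} (f : A → ℕ) (xs : List A) → sum (map f xs) ≡ ℕΣ.sum (f ∘ List.lookup xs)
sum-map≡Σ-lookup f []       = ≡.refl
sum-map≡Σ-lookup f (x ∷ xs) = ≡.cong (f x ℕ.+_) (sum-map≡Σ-lookup f xs)

chB-++ : ∀ {n} (cl cl′ : List (Subset n)) s → chB (cl ++ cl′) s ≡ chB cl s ℕ.+ chB cl′ s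
chB-++ cl cl′ s = ≡.trans (≡.cong sum (List.map-++ (λ I → FB I s) cl cl′))
                          (ℕListAction.sum-++ (map (λ I → FB I s) cl) _)

chB-++-sum-remove : ∀ {n N} (d : Fin (suc N) → Subset n) k₀ cl s →
  chB cl s ≡ ℕΣ.sum (λ k → FB (d (punchIn k₀ k)) s) →
  chB (cl ++ d k₀ ∷ []) s ≡ ℕΣ.sum (λ k → FB (d k) s)
chB-++-sum-remove d k₀ cl s cl-chB = begin
  chB (cl ++ d k₀ ∷ []) s                                  ≡⟨ chB-++ cl (d k₀ ∷ []) s ⟩
  chB cl s ℕ.+ (FB (d k₀) s ℕ.+ 0)                         ≡⟨ ≡.cong₂ ℕ._+_ cl-chB (ℕ.+-identityʳ _) ⟩
  ℕΣ.sum (λ k → FB (d (punchIn k₀ k)) s) ℕ.+ FB (d k₀) s  ≡⟨ ℕ.+-comm _ (FB (d k₀) s) ⟩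
  FB (d k₀) s ℕ.+ ℕΣ.sum (λ k → FB (d (punchIn k₀ k)) s)  ≡⟨ ℕΣ.sum-remove (λ k → FB (d k) s) ⟨
  ℕΣ.sum (λ k → FB (d k) s)                                ∎
  where open ≡.≡-Reasoning

module _ {c ℓ : Level} (K : Field c ℓ) {n : ℕ}
  {A M : Module (Field.commutativeRing K) c ℓ}
  {π′ : Fin n → Module.Carrierᴹ A → Module.Carrierᴹ A}
  {π  : Fin n → Module.Carrierᴹ M → Module.Carrierᴹ M}
  (f : Module.Carrierᴹ A → Module.Carrierᴹ M)
  where
  private
    module A = Module A
    module M = Module M

  IsHAction-pullback :
    (∀ {u v} → u A.≈ᴹ v → f u M.≈ᴹ f v) →
    (∀ u v → f (u A.+ᴹ v) M.≈ᴹ (f u M.+ᴹ f v)) →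
    (∀ a v → f (a A.*ₗ v) M.≈ᴹ (a M.*ₗ f v)) →
    (∀ v → f (A.-ᴹ v) M.≈ᴹ M.-ᴹ f v) →
    (∀ u v → f u M.≈ᴹ f v → u A.≈ᴹ v) →
    (∀ i v → f (π′ i v) M.≈ᴹ π i (f v)) →
    IsHAction K n M π → IsHAction K n A π′
  IsHAction-pullback f-cong f-+ f-* f-neg f-injective f-equivariant h = record
    { π-cong   = λ i p → reflect (lift¹ i) (H.π-cong i (f-cong p)) (lift¹ i)
    ; π-+      = λ i u v → reflect (lift i (f-+ u v)) (H.π-+ i (f u) (f v))
                   (M.≈ᴹ-trans (f-+ _ _) (M.+ᴹ-cong (lift¹ i) (lift¹ i)))
    ; π-*      = λ i a v → reflect (lift i (f-* a v)) (H.π-* i a (f v))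
                   (M.≈ᴹ-trans (f-* _ _) (M.*ₗ-congˡ (lift¹ i)))
    ; π-quad   = λ i v → reflect (lift² i i) (H.π-quad i (f v))
                   (M.≈ᴹ-trans (f-neg _) (M.-ᴹ‿cong (lift¹ i)))
    ; π-comm   = λ i j q v → reflect (lift² i j) (H.π-comm i j q (f v)) (lift² j i)
    ; π-braid  = λ i j q r v → reflect (lift i (lift² j i)) (H.π-braid i j q r (f v)) (lift j (lift² i j))
    ; π-braidB = λ i j q r v → reflect (lift i (lift j (lift² i j))) (H.π-braidB i j q r (f v))
                   (lift j (lift i (lift² j i)))
    }
    where
      module H = IsHAction h

      reflect : ∀ {u v x y} → f u M.≈ᴹ x → x M.≈ᴹ y → f v M.≈ᴹ y → u A.≈ᴹ v
      reflect fu≈x x≈y fv≈y = f-injective _ _ (M.≈ᴹ-trans fu≈x (M.≈ᴹ-trans x≈y (M.≈ᴹ-sym fv≈y)))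

      lift : ∀ i {w x} → f w M.≈ᴹ x → f (π′ i w) M.≈ᴹ π i x
      lift i p = M.≈ᴹ-trans (f-equivariant i _) (H.π-cong i p)

      lift¹ : ∀ i {w} → f (π′ i w) M.≈ᴹ π i (f w)
      lift¹ i = lift i M.≈ᴹ-refl

      lift² : ∀ i j {w} → f (π′ i (π′ j w)) M.≈ᴹ π i (π j (f w))
      lift² i j = lift i (lift¹ j)

module MatrixActions {c ℓ : Level} (K : Field c ℓ) where
  open Field K hiding (zero)
  open CommutativeMonoidSum +-commutativeMonoid using (sum-remove; sum-cong-≋; sum-replicate-zero)
    renaming (sum to Σᴷ)
  private
    module RP = RingProperties ring

  -- Agda cannot infer N from Kⁿ N, so the operations of Kpow K N are used qualified, with N explicit.
  Kⁿ : ℕ → Set c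
  Kⁿ N = Module.Carrierᴹ (Kpow K N)

  module Kpowᴹ (N : ℕ) = Module (Kpow K N)

  ≡⇒≈ : ∀ {x y} → x ≡ y → x ≈ y
  ≡⇒≈ ≡.refl = refl

  coord-cong : ∀ {N} {u v : Kⁿ N} → Kpowᴹ._≈ᴹ_ N u v → ∀ (k : Fin N) → coord K k u ≈ coord K k v
  coord-cong {suc N} (p , _) zero    = p
  coord-cong {suc N} (_ , q) (suc k) = coord-cong q k

  ≈ᴹ-by-coord : ∀ {N} {u v : Kⁿ N} → (∀ (k : Fin N) → coord K k u ≈ coord K k v) → Kpowᴹ._≈ᴹ_ N u v
  ≈ᴹ-by-coord {zero}  p = tt
  ≈ᴹ-by-coord {suc N} p = p zero , ≈ᴹ-by-coord (p ∘ suc)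

  coord-build : ∀ {N} (f : Fin N → Carrier) (k : Fin N) → coord K k (build K f) ≡ f k
  coord-build f zero    = ≡.refl
  coord-build f (suc k) = coord-build (f ∘ suc) k

  coord-+ᴹ : ∀ {N} (u v : Kⁿ N) (k : Fin N) → coord K k (Kpowᴹ._+ᴹ_ N u v) ≡ coord K k u + coord K k v
  coord-+ᴹ u v zero    = ≡.refl
  coord-+ᴹ (_ , u) (_ , v) (suc k) = coord-+ᴹ u v k

  coord-*ₗ : ∀ {N} a (v : Kⁿ N) (k : Fin N) → coord K k (Kpowᴹ._*ₗ_ N a v) ≡ a * coord K k v
  coord-*ₗ a v zero    = ≡.refl
  coord-*ₗ a (_ , v) (suc k) = coord-*ₗ a v k

  sumK≡Σ : ∀ {N} (f : Fin N → Carrier) → sumK K f ≡ Σᴷ f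
  sumK≡Σ {zero}  f = ≡.refl
  sumK≡Σ {suc N} f = ≡.cong (f zero +_) (sumK≡Σ (f ∘ suc))

  sumK-cong : ∀ {N} {f g : Fin N → Carrier} → (∀ k → f k ≈ g k) → sumK K f ≈ sumK K g
  sumK-cong {f = f} {g} p =
    trans (≡⇒≈ (sumK≡Σ f)) (trans (sum-cong-≋ p) (≡⇒≈ (≡.sym (sumK≡Σ g))))

  sumK-zero : ∀ {N} {f : Fin N → Carrier} → (∀ k → f k ≈ 0#) → sumK K f ≈ 0#
  sumK-zero {N} p =
    trans (sumK-cong {g = λ _ → 0#} p) (trans (≡⇒≈ (sumK≡Σ {N} (λ _ → 0#))) (sum-replicate-zero N))

  sumK-remove : ∀ {N} (k : Fin (suc N)) (f : Fin (suc N) → Carrier) →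
    sumK K f ≈ f k + sumK K (f ∘ punchIn k)
  sumK-remove k f = trans (≡⇒≈ (sumK≡Σ f))
    (trans (sum-remove f) (+-congˡ (≡⇒≈ (≡.sym (sumK≡Σ (f ∘ punchIn k))))))

  insertAt : ∀ {N} → Fin (suc N) → Carrier → Kⁿ N → Kⁿ (suc N)
  insertAt zero    x v = x , v
  insertAt {suc N} (suc k) x (y , v) = y , insertAt k x v

  removeAt : ∀ {N} → Fin (suc N) → Kⁿ (suc N) → Kⁿ N
  removeAt zero    (x , v) = v
  removeAt {suc N} (suc k) (y , v) = y , removeAt k v

  coord-insertAt : ∀ {N} (k : Fin (suc N)) x (v : Kⁿ N) → coord K k (insertAt k x v) ≡ x
  coord-insertAt zero    x v = ≡.refl
  coord-insertAt {suc N} (suc k) x (y , v) = coord-insertAt k x v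

  coord-insertAt-punchIn : ∀ {N} (k : Fin (suc N)) x (v : Kⁿ N) (j : Fin N) →
    coord K (punchIn k j) (insertAt k x v) ≡ coord K j v
  coord-insertAt-punchIn zero    x v j = ≡.refl
  coord-insertAt-punchIn {suc N} (suc k) x (y , v) zero    = ≡.refl
  coord-insertAt-punchIn {suc N} (suc k) x (y , v) (suc j) = coord-insertAt-punchIn k x v j

  insertAt-removeAt : ∀ {N} (k : Fin (suc N)) (v : Kⁿ (suc N)) →
    insertAt k (coord K k v) (removeAt k v) ≡ v
  insertAt-removeAt zero    (x , v) = ≡.refl
  insertAt-removeAt {suc N} (suc k) (y , v) = ≡.cong (y ,_) (insertAt-removeAt k v)

  insertAt-cong : ∀ {N} (k : Fin (suc N)) {x y} {u v : Kⁿ N} → x ≈ y → Kpowᴹ._≈ᴹ_ N u v →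
    Kpowᴹ._≈ᴹ_ (suc N) (insertAt k x u) (insertAt k y v)
  insertAt-cong zero    p q = p , q
  insertAt-cong {suc N} (suc k) p (q , r) = q , insertAt-cong k p r

  insertAt-injective : ∀ {N} (k : Fin (suc N)) {x y} {u v : Kⁿ N} →
    Kpowᴹ._≈ᴹ_ (suc N) (insertAt k x u) (insertAt k y v) → Kpowᴹ._≈ᴹ_ N u v
  insertAt-injective zero    (_ , q) = q
  insertAt-injective {suc N} (suc k) {u = _ , _} {_ , _} (p , q) = p , insertAt-injective k q

  insertAt-+ᴹ : ∀ {N} (k : Fin (suc N)) x y (u v : Kⁿ N) →
    insertAt k (x + y) (Kpowᴹ._+ᴹ_ N u v) ≡ Kpowᴹ._+ᴹ_ (suc N) (insertAt k x u) (insertAt k y v)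
  insertAt-+ᴹ zero    x y u v = ≡.refl
  insertAt-+ᴹ {suc N} (suc k) x y (_ , u) (_ , v) = ≡.cong (_ ,_) (insertAt-+ᴹ k x y u v)

  insertAt-*ₗ : ∀ {N} (k : Fin (suc N)) a x (v : Kⁿ N) →
    insertAt k (a * x) (Kpowᴹ._*ₗ_ N a v) ≡ Kpowᴹ._*ₗ_ (suc N) a (insertAt k x v)
  insertAt-*ₗ zero    a x v = ≡.refl
  insertAt-*ₗ {suc N} (suc k) a x (_ , v) = ≡.cong (_ ,_) (insertAt-*ₗ k a x v)

  insertAt--ᴹ : ∀ {N} (k : Fin (suc N)) x (v : Kⁿ N) →
    insertAt k (- x) (Kpowᴹ.-ᴹ_ N v) ≡ Kpowᴹ.-ᴹ_ (suc N) (insertAt k x v)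
  insertAt--ᴹ zero    x v = ≡.refl
  insertAt--ᴹ {suc N} (suc k) x (_ , v) = ≡.cong (_ ,_) (insertAt--ᴹ k x v)

  matrixAction : ∀ {n N} → (Fin n → Fin N → Fin N → Carrier) → Fin n → Kⁿ N → Kⁿ N
  matrixAction e i v = build K (λ j → sumK K (λ k → e i j k * coord K k v))

  matrixModule : ∀ {n N} (e : Fin n → Fin N → Fin N → Carrier) →
    IsHAction K n (Kpow K N) (matrixAction e) → HMod K n
  matrixModule {N = N} e h = record { M = Kpow K N ; π = matrixAction e ; isH = h }

  coord-matrixAction : ∀ {n N} (e : Fin n → Fin N → Fin N → Carrier) i v (j : Fin N) →
    coord K j (matrixAction e i v) ≡ sumK K (λ k → e i j k * coord K k v)
  coord-matrixAction e i v = coord-build (λ j → sumK K (λ k → e i j k * coord K k v))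

  eigenvalue : Bool → Carrier
  eigenvalue b = if b then - 1# else 0#

  S-π : ∀ {n} (I : Subset n) i x → HMod.π (S K I) i x ≈ eigenvalue (lookup I i) * x
  S-π I i x with lookup I i
  ... | true  = trans (-‿cong (sym (*-identityˡ x))) (RP.-‿distribˡ-* 1# x)
  ... | false = sym (zeroˡ x)

  ≈ᴹ-by-coord-around : ∀ {N} (k₀ : Fin (suc N)) {u v : Kⁿ (suc N)} →
    coord K k₀ u ≈ coord K k₀ v → (∀ j → coord K (punchIn k₀ j) u ≈ coord K (punchIn k₀ j) v) →
    Kpowᴹ._≈ᴹ_ (suc N) u v
  ≈ᴹ-by-coord-around k₀ {u} {v} at-k₀ elsewhere = ≈ᴹ-by-coord at
    where
      at : ∀ k → coord K k u ≈ coord K k v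
      at k with k₀ ≟ k
      ... | yes ≡.refl = at-k₀
      ... | no k₀≢k    = ≡.subst (λ k → coord K k u ≈ coord K k v)
                           (punchIn-punchOut k₀≢k) (elsewhere (punchOut k₀≢k))

  sumK-insertAt-0# : ∀ {N} (k₀ : Fin (suc N)) (a : Fin (suc N) → Carrier) (v : Kⁿ N) →
    sumK K (λ k → a k * coord K k (insertAt k₀ 0# v)) ≈ sumK K (λ j → a (punchIn k₀ j) * coord K j v)
  sumK-insertAt-0# k₀ a v = begin
    sumK K (λ k → a k * coord K k (insertAt k₀ 0# v))
      ≈⟨ sumK-remove k₀ (λ k → a k * coord K k (insertAt k₀ 0# v)) ⟩
    a k₀ * coord K k₀ (insertAt k₀ 0# v)
      + sumK K (λ j → a (punchIn k₀ j) * coord K (punchIn k₀ j) (insertAt k₀ 0# v))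
      ≈⟨ +-cong (trans (*-congˡ (≡⇒≈ (coord-insertAt k₀ 0# v))) (zeroʳ _))
                (sumK-cong (λ j → *-congˡ (≡⇒≈ (coord-insertAt-punchIn k₀ 0# v j)))) ⟩
    0# + sumK K (λ j → a (punchIn k₀ j) * coord K j v)
      ≈⟨ +-identityˡ _ ⟩
    sumK K (λ j → a (punchIn k₀ j) * coord K j v) ∎
    where open SetoidReasoning setoid

  module Peel {n N : ℕ} (e : Fin n → Fin (suc N) → Fin (suc N) → Carrier) (k₀ : Fin (suc N))
              (row-k₀ : ∀ i j → e i k₀ (punchIn k₀ j) ≈ 0#) where

    minor : Fin n → Fin N → Fin N → Carrier
    minor i j k = e i (punchIn k₀ j) (punchIn k₀ k)

    row-k₀-vanishes : ∀ i j x → e i k₀ (punchIn k₀ j) * x ≈ 0#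
    row-k₀-vanishes i j x = trans (*-congʳ (row-k₀ i j)) (zeroˡ x)

    embed : Kⁿ N → Kⁿ (suc N)
    embed = insertAt k₀ 0#

    embed-equivariant : ∀ i v →
      Kpowᴹ._≈ᴹ_ (suc N) (embed (matrixAction minor i v)) (matrixAction e i (embed v))
    embed-equivariant i v = ≈ᴹ-by-coord-around k₀ at-k₀ elsewhere
      where
        open SetoidReasoning setoid
        at-k₀ : coord K k₀ (embed (matrixAction minor i v)) ≈ coord K k₀ (matrixAction e i (embed v))
        at-k₀ = begin
          coord K k₀ (embed (matrixAction minor i v))          ≡⟨ coord-insertAt k₀ 0# _ ⟩
          0#                                                   ≈⟨ sumK-zero (λ j → row-k₀-vanishes i j _) ⟨
          sumK K (λ j → e i k₀ (punchIn k₀ j) * coord K j v)  ≈⟨ sumK-insertAt-0# k₀ (e i k₀) v ⟨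
          sumK K (λ k → e i k₀ k * coord K k (embed v))        ≡⟨ coord-matrixAction e i (embed v) k₀ ⟨
          coord K k₀ (matrixAction e i (embed v))              ∎
        elsewhere : ∀ j → coord K (punchIn k₀ j) (embed (matrixAction minor i v))
                          ≈ coord K (punchIn k₀ j) (matrixAction e i (embed v))
        elsewhere j = begin
          coord K (punchIn k₀ j) (embed (matrixAction minor i v))  ≡⟨ coord-insertAt-punchIn k₀ 0# _ j ⟩
          coord K j (matrixAction minor i v)                       ≡⟨ coord-matrixAction minor i v j ⟩
          sumK K (λ k → minor i j k * coord K k v)
            ≈⟨ sumK-insertAt-0# k₀ (e i (punchIn k₀ j)) v ⟨
          sumK K (λ k → e i (punchIn k₀ j) k * coord K k (embed v))
            ≡⟨ coord-matrixAction e i (embed v) (punchIn k₀ j) ⟨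
          coord K (punchIn k₀ j) (matrixAction e i (embed v))      ∎

    coord-k₀-equivariant : ∀ i v → coord K k₀ (matrixAction e i v) ≈ e i k₀ k₀ * coord K k₀ v
    coord-k₀-equivariant i v = begin
      coord K k₀ (matrixAction e i v)                   ≡⟨ coord-matrixAction e i v k₀ ⟩
      sumK K (λ k → e i k₀ k * coord K k v)             ≈⟨ sumK-remove k₀ (λ k → e i k₀ k * coord K k v) ⟩
      e i k₀ k₀ * coord K k₀ v + sumK K (λ j → e i k₀ (punchIn k₀ j) * coord K (punchIn k₀ j) v)
        ≈⟨ +-congˡ (sumK-zero (λ j → row-k₀-vanishes i j _)) ⟩
      e i k₀ k₀ * coord K k₀ v + 0#                     ≈⟨ +-identityʳ _ ⟩
      e i k₀ k₀ * coord K k₀ v                          ∎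
      where open SetoidReasoning setoid

    private
      module Kpowᴹ⁺¹ = Kpowᴹ (suc N)

      0#≈0#+0# : 0# ≈ 0# + 0#
      0#≈0#+0# = sym (+-identityʳ 0#)

      embed-cong : ∀ {u v} → Kpowᴹ._≈ᴹ_ N u v → embed u Kpowᴹ⁺¹.≈ᴹ embed v
      embed-cong = insertAt-cong k₀ refl

      embed-+ᴹ : ∀ u v → embed (Kpowᴹ._+ᴹ_ N u v) Kpowᴹ⁺¹.≈ᴹ (embed u Kpowᴹ⁺¹.+ᴹ embed v)
      embed-+ᴹ u v = Kpowᴹ⁺¹.≈ᴹ-trans (insertAt-cong k₀ 0#≈0#+0# (Kpowᴹ.≈ᴹ-refl N))
                                      (Kpowᴹ⁺¹.≈ᴹ-reflexive (insertAt-+ᴹ k₀ 0# 0# u v))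

      embed-*ₗ : ∀ a v → embed (Kpowᴹ._*ₗ_ N a v) Kpowᴹ⁺¹.≈ᴹ (a Kpowᴹ⁺¹.*ₗ embed v)
      embed-*ₗ a v = Kpowᴹ⁺¹.≈ᴹ-trans (insertAt-cong k₀ (sym (zeroʳ a)) (Kpowᴹ.≈ᴹ-refl N))
                                      (Kpowᴹ⁺¹.≈ᴹ-reflexive (insertAt-*ₗ k₀ a 0# v))

      embed--ᴹ : ∀ v → embed (Kpowᴹ.-ᴹ_ N v) Kpowᴹ⁺¹.≈ᴹ (Kpowᴹ⁺¹.-ᴹ embed v)
      embed--ᴹ v = Kpowᴹ⁺¹.≈ᴹ-trans (insertAt-cong k₀ (sym RP.-0#≈0#) (Kpowᴹ.≈ᴹ-refl N))
                                    (Kpowᴹ⁺¹.≈ᴹ-reflexive (insertAt--ᴹ k₀ 0# v))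

    minor-isHAction : IsHAction K n (Kpow K (suc N)) (matrixAction e) →
                      IsHAction K n (Kpow K N) (matrixAction minor)
    minor-isHAction = IsHAction-pullback K embed embed-cong embed-+ᴹ embed-*ₗ embed--ᴹ
      (λ u v → insertAt-injective k₀) embed-equivariant

    peel : (h : IsHAction K n (Kpow K (suc N)) (matrixAction e)) (I : Subset n) →
           (∀ i → e i k₀ k₀ ≈ eigenvalue (lookup I i)) →
           SES K (matrixModule minor (minor-isHAction h)) (matrixModule e h) (S K I)
    peel h I diagonal = record
      { f      = embed
      ; g      = coord K k₀
      ; f-hom  = record { f-cong = embed-cong ; f-+ = embed-+ᴹ ; f-* = embed-*ₗ ; f-equiv = embed-equivariant }
      ; g-hom  = record
        { f-cong  = λ p → coord-cong p k₀
        ; f-+     = λ u v → ≡⇒≈ (coord-+ᴹ u v k₀)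
        ; f-*     = λ a v → ≡⇒≈ (coord-*ₗ a v k₀)
        ; f-equiv = λ i v → trans (coord-k₀-equivariant i v)
                                  (trans (*-congʳ (diagonal i)) (sym (S-π I i _)))
        }
      ; f-inj  = λ u v → insertAt-injective k₀
      ; g-surj = λ y → insertAt k₀ y (Kpowᴹ.0ᴹ N) , ≡⇒≈ (coord-insertAt k₀ y _)
      ; gf≈0   = λ v → ≡⇒≈ (coord-insertAt k₀ 0# v)
      ; ker⊆im = λ v v₀≈0 → removeAt k₀ v , Kpowᴹ⁺¹.≈ᴹ-trans
                   (insertAt-cong k₀ (sym v₀≈0) (Kpowᴹ.≈ᴹ-refl N))
                   (Kpowᴹ⁺¹.≈ᴹ-reflexive (insertAt-removeAt k₀ v))
      }

  triangular-hasClass : ∀ {n} N (e : Fin n → Fin N → Fin N → Carrier) (d : Fin N → Subset n)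
    (ρ : Fin N → ℕ) → (∀ i k → e i k k ≈ eigenvalue (lookup (d k) i)) →
    (∀ i j k → j ≢ k → ρ j ≤ ρ k → e i j k ≈ 0#) →
    (h : IsHAction K n (Kpow K N) (matrixAction e)) →
    Σ (List (Subset n)) λ cl →
      HasClass K (matrixModule e h) cl × (∀ s → chB cl s ≡ ℕΣ.sum (λ k → FB (d k) s))
  triangular-hasClass zero    e d ρ diagonal triangular h = [] , trivial _ (λ _ → tt) , λ _ → ≡.refl
  triangular-hasClass (suc N) e d ρ diagonal triangular h =
    let cl , cl-class , cl-chB = triangular-hasClass N minor (d ∘ punchIn k₀) (ρ ∘ punchIn k₀)
                                   (λ i k → diagonal i (punchIn k₀ k))
                                   (λ i j k j≢k → triangular i _ _ (j≢k ∘ punchIn-injective k₀ j k))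
                                   (minor-isHAction h)
    in cl ++ d k₀ ∷ [] , ext (peel h (d k₀) (λ i → diagonal i k₀)) cl-class (simple (d k₀))
     , λ s → chB-++-sum-remove d k₀ cl s (cl-chB s)
    where
      k₀ : Fin (suc N)
      k₀ = proj₁ (argmin-Fin ρ)
      open Peel e k₀ (λ i j → triangular i k₀ (punchIn k₀ j) (punchInᵢ≢i k₀ j ∘ ≡.sym)
                                         (proj₂ (argmin-Fin ρ) _))

open import Data.Nat using (_+_; _*_)

private
  T-∧⁻ : ∀ {x y} → T (x ∧ y) → T x × T y
  T-∧⁻ = Equivalence.to T-∧

  T-∧⁺ : ∀ {x y} → T x × T y → T (x ∧ y)
  T-∧⁺ = Equivalence.from T-∧

  ≡ᵇ-refl : ∀ m → T (m ≡ᵇ m)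
  ≡ᵇ-refl m = ℕ.≡⇒≡ᵇ m m ≡.refl

cellEq⇒≡ : ∀ p q → T (cellEq p q) → p ≡ q
cellEq⇒≡ (a , b) (a′ , b′) t with T-∧⁻ t
... | ta , tb = ≡.cong₂ _,_ (ℕ.≡ᵇ⇒≡ a a′ ta) (ℕ.≡ᵇ⇒≡ b b′ tb)

member⇒∈ : ∀ {p} xs → T (member p xs) → p ∈ xs
member⇒∈ {p} xs t = Any.map (cellEq⇒≡ p _) (any⁻ (cellEq p) xs t)

∈-diagram⁻ : ∀ la {r c} → (r , c) ∈ diagram la → r < length la × c < part la r
∈-diagram⁻ la m with find (∈-concatMap⁻ _ {xs = upTo (length la)} m)
... | r , r∈ , m′ with ∈-map⁻ _ m′
...   | c , c∈ , ≡.refl = ∈-upTo⁻ r∈ , ∈-upTo⁻ c∈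

∈-diagram⁺ : ∀ la {r c} → r < length la → c < part la r → (r , c) ∈ diagram la
∈-diagram⁺ la r< c< = ∈-concatMap⁺ _ (lose (∈-upTo⁺ r<) (∈-map⁺ _ (∈-upTo⁺ c<)))

∈-diagram-left : ∀ la {r c} → (r , suc c) ∈ diagram la → (r , c) ∈ diagram la
∈-diagram-left la m with ∈-diagram⁻ la m
... | r< , c< = ∈-diagram⁺ la r< (ℕ.<-trans (ℕ.n<1+n _) c<)

record Standard {n : ℕ} (la : List ℕ) (t : Filling n) : Set where
  field
    inside   : ∀ {p} b → p ∈ cells (lookup t b) → p ∈ diagram la
    covering : ∀ {p} → p ∈ diagram la → Σ (Fin n) λ b → p ∈ cells (lookup t b)
    monotone : ∀ {p q} a b → p ∈ cells (lookup t a) → q ∈ cells (lookup t b) →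
               T (nextTo p q) → toℕ a ≤ toℕ b

isSDT⇒Standard : ∀ {n} la (t : Filling n) → T (isSDT la t) → Standard la t
isSDT⇒Standard {n} la t sdt with T-∧⁻ {distinct (allCells t)} sdt
... | _ , sdt′ with T-∧⁻ {all (λ p → member p (diagram la)) (allCells t)} sdt′
... | inside? , sdt″ with T-∧⁻ {all (λ p → member p (allCells t)) (diagram la)} sdt″
... | covered? , monotone? = record
  { inside   = λ b p∈ → member⇒∈ (diagram la) (All.lookup (all⁺ _ _ inside?) (∈-allCells b p∈))
  ; covering = λ p∈ → allCells⇒∈ (member⇒∈ (allCells t) (All.lookup (all⁺ _ _ covered?) p∈))
  ; monotone = monotone
  }
  where
    ∈-allCells : ∀ {p} b → p ∈ cells (lookup t b) → p ∈ allCells t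
    ∈-allCells b p∈ = ∈-concatMap⁺ cells (VecAny.toList⁺ (Vec.lose (Vec.∈-lookup b t) p∈))

    allCells⇒∈ : ∀ {p} → p ∈ allCells t → Σ (Fin n) λ b → p ∈ cells (lookup t b)
    allCells⇒∈ p∈ = let a = VecAny.toList⁻ {xs = t} (∈-concatMap⁻ cells p∈)
                    in VecAny.index a , VecAny.lookup-index a

    monotone : ∀ {p q} a b → p ∈ cells (lookup t a) → q ∈ cells (lookup t b) →
               T (nextTo p q) → toℕ a ≤ toℕ b
    monotone {p} {q} a b p∈ q∈ adjacent
      with Equivalence.to T-∨ (All.lookup (all⁺ _ _ (All.lookup (all⁺ _ _ monotone?) (∈-allFin a))) (∈-allFin b))
    ... | inj₂ a≤ᵇb  = ℕ.≤ᵇ⇒≤ (toℕ a) (toℕ b) a≤ᵇb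
    ... | inj₁ apart = ⊥-elim (≡.subst T (Equivalence.to T-not-≡ apart)
                                         (any⁺ _ (lose p∈ (any⁺ _ (lose q∈ adjacent)))))

nextTo-right : ∀ r c → T (nextTo (r , c) (r , suc c))
nextTo-right r c = Equivalence.from T-∨ (inj₁ (T-∧⁺ (≡ᵇ-refl r , ≡ᵇ-refl c)))

nextTo-down : ∀ r c → T (nextTo (r , c) (suc r , c))
nextTo-down r c = Equivalence.from T-∨ (inj₂ (T-∧⁺ (≡ᵇ-refl c , ≡ᵇ-refl r)))

module _ {n : ℕ} {la : List ℕ} {t : Filling n} (std : Standard la t) where
  open Standard std

  row-monotone : ∀ {r x y} a b → (r , x) ∈ cells (lookup t a) → (r , y) ∈ cells (lookup t b) →
                 x < y → toℕ a ≤ toℕ b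
  row-monotone {r} {x} {suc y} a b x∈a y∈b (s≤s x≤y) with ℕ.m≤n⇒m<n∨m≡n x≤y
  ... | inj₂ ≡.refl = monotone a b x∈a y∈b (nextTo-right r x)
  ... | inj₁ x<y    with covering (∈-diagram-left la (inside b y∈b))
  ...   | b′ , y∈b′ =
    ℕ.≤-trans (row-monotone a b′ x∈a y∈b′ x<y) (monotone b′ b y∈b′ y∈b (nextTo-right r y))

topRow : ∀ {m} → Domino m → ℕ
topRow d = toℕ (proj₁ d)

topLeft∈cells : ∀ {m} (d : Domino m) → (topRow d , toℕ (proj₁ (proj₂ d))) ∈ cells d
topLeft∈cells (_ , _ , true)  = here ≡.refl
topLeft∈cells (_ , _ , false) = here ≡.refl

SharedRowsAligned : ∀ {m} → Domino m → Domino m → Set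
SharedRowsAligned A B = ∀ {p q} → p ∈ cells A → q ∈ cells B → proj₁ p ≡ proj₁ q → proj₂ p ≡ proj₂ q

NoCellDirectlyBelow : ∀ {m} → Domino m → Domino m → Set
NoCellDirectlyBelow A B =
  ∀ {p q} → p ∈ cells A → q ∈ cells B → proj₂ p ≡ proj₂ q → suc (proj₁ p) ≢ proj₁ q

rows-overlap-impossible : ∀ {m} (A B : Domino m) → SharedRowsAligned A B → NoCellDirectlyBelow A B →
  topRow A ≤ topRow B → topRow B ≤ bottomRow A → ⊥
rows-overlap-impossible (rA , cA , false) B aligned _ A≤B B≤A =
  ℕ.1+n≢n (≡.trans (aligned (there (here ≡.refl)) (topLeft∈cells B) same-row)
                   (≡.sym (aligned (here ≡.refl) (topLeft∈cells B) same-row)))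
  where same-row = ℕ.≤-antisym A≤B B≤A
rows-overlap-impossible (rA , cA , true) B aligned below A≤B B≤A with ℕ.m≤n⇒m<n∨m≡n A≤B
rows-overlap-impossible (rA , cA , true) (rB , cB , true) aligned below A≤B B≤A | inj₂ same-row =
  below (here ≡.refl) (there (here ≡.refl)) (aligned (here ≡.refl) (here ≡.refl) same-row) (≡.cong suc same-row)
rows-overlap-impossible (rA , cA , true) (rB , cB , false) aligned below A≤B B≤A | inj₂ same-row =
  ℕ.1+n≢n (≡.trans (≡.sym (aligned (here ≡.refl) (there (here ≡.refl)) same-row))
                   (aligned (here ≡.refl) (here ≡.refl) same-row))
rows-overlap-impossible (rA , cA , true) B aligned below A≤B B≤A | inj₁ A<B =
  below (here ≡.refl) (topLeft∈cells B) (aligned (there (here ≡.refl)) (topLeft∈cells B) next-row) next-row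
  where next-row = ℕ.≤-antisym A<B B≤A

topRow-< : ∀ {m} (A B : Domino m) → SharedRowsAligned A B → NoCellDirectlyBelow A B →
  topRow B ≤ bottomRow A → topRow B < topRow A
topRow-< A B aligned below B≤A with topRow A ≤? topRow B
... | yes A≤B = ⊥-elim (rows-overlap-impossible A B aligned below A≤B B≤A)
... | no  A≰B = ℕ.≰⇒> A≰B

-- Vertical dominoes weigh 2 so that s₀, which lifts dom₂ by one row but makes two dominoes
-- vertical, still raises the rank.
verticalWeight : ∀ {m} → Domino m → ℕ
verticalWeight (_ , _ , v) = if v then 2 else 0

rowSum : ∀ {m k} → Vec (Domino m) k → ℕ
rowSum t = Vec.sum (Vec.map topRow t)

rowMoment : ∀ {m k} → Vec (Domino m) k → ℕ
rowMoment []       = 0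
rowMoment (d ∷ ds) = rowSum (d ∷ ds) + rowMoment ds

rank : ∀ {m k} → Vec (Domino m) k → ℕ
rank t = rowMoment t + Vec.sum (Vec.map verticalWeight t)

swap : ∀ {A : Set} {k} → Vec A (suc k) → Fin k → Vec A (suc k)
swap t j = (t [ inject₁ j ]≔ lookup t (suc j)) [ suc j ]≔ lookup t (inject₁ j)

lookup-swap-suc : ∀ {A : Set} {k} (t : Vec A (suc k)) j → lookup (swap t j) (suc j) ≡ lookup t (inject₁ j)
lookup-swap-suc (x ∷ y ∷ t) zero    = ≡.refl
lookup-swap-suc (x ∷ t)     (suc j) = lookup-swap-suc t j

lookup-swap-inject₁ : ∀ {A : Set} {k} (t : Vec A (suc k)) j → lookup (swap t j) (inject₁ j) ≡ lookup t (suc j)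
lookup-swap-inject₁ (x ∷ y ∷ t) zero    = ≡.refl
lookup-swap-inject₁ (x ∷ t)     (suc j) = lookup-swap-inject₁ t j

sum-map-swap : ∀ {A : Set} {k} (f : A → ℕ) (t : Vec A (suc k)) j →
  Vec.sum (Vec.map f (swap t j)) ≡ Vec.sum (Vec.map f t)
sum-map-swap f (x ∷ y ∷ t) zero    = x∙yz≈y∙xz (f y) (f x) _
sum-map-swap f (x ∷ t)     (suc j) = ≡.cong (f x +_) (sum-map-swap f t j)

rowMoment-swap : ∀ {m k} (t : Vec (Domino m) (suc k)) j →
  topRow (lookup t (suc j)) < topRow (lookup t (inject₁ j)) → rowMoment t < rowMoment (swap t j)
rowMoment-swap (x ∷ y ∷ t) zero    y<x =
  ℕ.+-mono-≤-< (ℕ.≤-reflexive (x∙yz≈y∙xz (topRow x) (topRow y) _))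
                (ℕ.+-monoˡ-< (rowMoment t) (ℕ.+-monoˡ-< (rowSum t) y<x))
rowMoment-swap (x ∷ t)     (suc j) lt rewrite sum-map-swap topRow t j =
  ℕ.+-monoʳ-< (topRow x + rowSum t) (rowMoment-swap t j lt)

rank-swap : ∀ {m k} (t : Vec (Domino m) (suc k)) j →
  topRow (lookup t (suc j)) < topRow (lookup t (inject₁ j)) → rank t < rank (swap t j)
rank-swap t j lt rewrite sum-map-swap verticalWeight t j = ℕ.+-monoˡ-< _ (rowMoment-swap t j lt)

private
  if-just : ∀ {A : Set} b {x y : A} → (if b then just x else nothing) ≡ just y → T b × x ≡ y
  if-just true ≡.refl = _ , ≡.refl

  s0-rank-< : ∀ r S M V → (r + (1 + S) + (1 + S + M)) + (0 + (0 + V))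
                          < (r + (0 + S) + (0 + S + M)) + (2 + (2 + V))
  s0-rank-< r S M V = ≡.subst (before <_) (identity r S M V) (ℕ.m<n+m before {2} (s≤s z≤n))
    where
      before : ℕ
      before = (r + (1 + S) + (1 + S + M)) + (0 + (0 + V))
      identity : ∀ r S M V → 2 + ((r + (1 + S) + (1 + S + M)) + (0 + (0 + V)))
                             ≡ (r + (0 + S) + (0 + S + M)) + (2 + (2 + V))
      identity = solve-∀

rank-s0 : ∀ {m k} (t t′ : Vec (Domino m) (suc k)) → proj₂ (proj₂ (lookup t zero)) ≡ false →
  s0 t ≡ just t′ → rank t < rank t′
rank-s0 ((r₁ , c₁ , false) ∷ (r₂ , c₂ , false) ∷ ds) t′ _ s0≡ with if-just _ s0≡
... | cond , ≡.refl with T-∧⁻ {toℕ r₁ ≡ᵇ 0} cond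
... | _ , cond′ with T-∧⁻ {toℕ c₁ ≡ᵇ 0} cond′
... | _ , cond″ with T-∧⁻ {toℕ r₂ ≡ᵇ 1} cond″
... | r₂≡1 , c₂≡0 rewrite ℕ.≡ᵇ⇒≡ (toℕ r₂) 1 r₂≡1 | ℕ.≡ᵇ⇒≡ (toℕ c₂) 0 c₂≡0 =
  s0-rank-< (toℕ r₁) (rowSum ds) (rowMoment ds) (Vec.sum (Vec.map verticalWeight ds))
rank-s0 ((_ , _ , false) ∷ (_ , _ , true) ∷ _) _ _ ()
rank-s0 ((_ , _ , false) ∷ []) _ _ ()
rank-s0 ((_ , _ , true) ∷ _) _ () _

private
  suc≰inject₁ : ∀ {k} (j : Fin k) → toℕ (suc j) ≤ toℕ (inject₁ j) → ⊥
  suc≰inject₁ j le rewrite toℕ-inject₁ j = ℕ.1+n≰n le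

  <ᵇ≡false⇒≥ : ∀ m n → (m <ᵇ n) ≡ false → n ≤ m
  <ᵇ≡false⇒≥ m n eq = ℕ.≮⇒≥ (λ m<n → ≡.subst T eq (ℕ.<⇒<ᵇ m<n))

-- Entries i and i+1 lie in A and B in t, and the other way round in swap t j.  As both are
-- standard, A and B cannot share a row in different columns, nor can B lie directly below A.
module _ {n : ℕ} {la : List ℕ} {t : Filling (suc n)} (j : Fin n)
         (std : Standard la t) (std′ : Standard la (swap t j)) where

  private
    A B : Domino (2 * suc n)
    A = lookup t (inject₁ j)
    B = lookup t (suc j)

    A∈swap : ∀ {p} → p ∈ cells A → p ∈ cells (lookup (swap t j) (suc j))
    A∈swap {p} = ≡.subst (λ d → p ∈ cells d) (≡.sym (lookup-swap-suc t j))

    B∈swap : ∀ {p} → p ∈ cells B → p ∈ cells (lookup (swap t j) (inject₁ j))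
    B∈swap {p} = ≡.subst (λ d → p ∈ cells d) (≡.sym (lookup-swap-inject₁ t j))

  swap-aligned : SharedRowsAligned A B
  swap-aligned {r , x} {.r , y} p∈A q∈B ≡.refl with ℕ.<-cmp x y
  ... | tri< x<y _ _ =
    ⊥-elim (suc≰inject₁ j (row-monotone std′ (suc j) (inject₁ j) (A∈swap p∈A) (B∈swap q∈B) x<y))
  ... | tri≈ _ x≡y _ = x≡y
  ... | tri> _ _ y<x = ⊥-elim (suc≰inject₁ j (row-monotone std (suc j) (inject₁ j) q∈B p∈A y<x))

  swap-not-below : NoCellDirectlyBelow A B
  swap-not-below {r , x} {.(suc r) , .x} p∈A q∈B ≡.refl ≡.refl =
    suc≰inject₁ j (Standard.monotone std′ (suc j) (inject₁ j) (A∈swap p∈A) (B∈swap q∈B) (nextTo-down r x))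

  rank-swap-ascent : isDes t (suc j) ≡ false → rank t < rank (swap t j)
  rank-swap-ascent asc = rank-swap t j
    (topRow-< A B swap-aligned swap-not-below (<ᵇ≡false⇒≥ (bottomRow A) (topRow B) asc))

rank-sOp : ∀ {n} {la} (t t′ : Filling n) i → Standard la t → Standard la t′ →
  isDes t i ≡ false → sOp i t ≡ just t′ → rank t < rank t′
rank-sOp t t′ zero    _   _    asc s0≡   = rank-s0 t t′ asc s0≡
rank-sOp t _  (suc j) std std′ asc ≡.refl = rank-swap-ascent j std std′ asc

domEq⇒≡ : ∀ {m} (d e : Domino m) → T (domEq d e) → d ≡ e
domEq⇒≡ (r , c , v) (r′ , c′ , v′) t with Equivalence.to T-∧ t
... | r≡ , t′ with Equivalence.to T-∧ t′
... | c≡ , v≡ = ≡.cong₂ _,_ (toℕ-injective (ℕ.≡ᵇ⇒≡ _ _ r≡))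
                              (≡.cong₂ _,_ (toℕ-injective (ℕ.≡ᵇ⇒≡ _ _ c≡)) (orientation v v′ v≡))
  where
    orientation : ∀ v v′ → T (if v then v′ else not v′) → v ≡ v′
    orientation true  true  _ = ≡.refl
    orientation false false _ = ≡.refl

fillEq⇒≡ : ∀ {m k} (xs ys : Vec (Domino m) k) → T (fillEq xs ys) → xs ≡ ys
fillEq⇒≡ []       []       _ = ≡.refl
fillEq⇒≡ (d ∷ ds) (e ∷ es) t with Equivalence.to T-∧ t
... | d≡e , ds≡es = ≡.cong₂ _∷_ (domEq⇒≡ d e d≡e) (fillEq⇒≡ ds es ds≡es)

module _ {c ℓ : Level} (K : Field c ℓ) (n : ℕ) (la : List ℕ) where
  open Field K using (_≈_; refl; 0#)
  open MatrixActions K using (eigenvalue)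

  private
    tableau : Fin (N K n la) → Filling n
    tableau = tab K n la

    standard : ∀ k → Standard la (tableau k)
    standard k = isSDT⇒Standard la (tableau k)
      (proj₂ (∈-filter⁻ (T? ∘ isSDT la) {xs = allVecs (allDominoes (2 * n)) n} (∈-lookup {xs = SDT n la} k)))

    step-raises-rank : ∀ i j k {t′} → isDes (tableau k) i ≡ false → sOp i (tableau k) ≡ just t′ →
      fillEq t′ (tableau j) ≡ true → rank (tableau k) < rank (tableau j)
    step-raises-rank i j k {t′} asc s≡ same with fillEq⇒≡ t′ (tableau j) (Equivalence.from T-≡ same)
    ... | ≡.refl = rank-sOp (tableau k) _ i (standard k) (standard j) asc s≡

  entry-diagonal : ∀ i k → entry K n la i k k ≈ eigenvalue (lookup (Des (tableau k)) i)
  entry-diagonal i k rewrite lookup∘tabulate (isDes (tableau k)) i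
    with isDes (tableau k) i in asc | sOp i (tableau k) in s≡
  ... | true  | _ rewrite Equivalence.to T-≡ (≡ᵇ-refl (toℕ k)) = refl
  ... | false | nothing = refl
  ... | false | just t′ with fillEq t′ (tableau k) in same
  ...   | false = refl
  ...   | true  = ⊥-elim (ℕ.<-irrefl ≡.refl (step-raises-rank i k k asc s≡ same))

  entry-triangular : ∀ i j k → j ≢ k → rank (tableau j) ≤ rank (tableau k) → entry K n la i j k ≈ 0#
  entry-triangular i j k j≢k j≤k with isDes (tableau k) i in asc | sOp i (tableau k) in s≡
  ... | true  | _ with toℕ j ≡ᵇ toℕ k in j≡ᵇk
  ...   | false = refl
  ...   | true  = ⊥-elim (j≢k (toℕ-injective (ℕ.≡ᵇ⇒≡ _ _ (Equivalence.from T-≡ j≡ᵇk))))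
  entry-triangular i j k j≢k j≤k | false | nothing = refl
  entry-triangular i j k j≢k j≤k | false | just t′ with fillEq t′ (tableau j) in same
  ...   | false = refl
  ...   | true  = ⊥-elim (ℕ.<⇒≱ (step-raises-rank i j k asc s≡ same) j≤k)

theorem4p3 : {c ℓ : Level} (K : Field c ℓ) (n : ℕ) (shape : List ℕ) →
    IsPartition shape → sum shape ≡ 2 * n →
    (h : IsHAction K n (CSDTspace K n shape) (CSDTact K n shape)) →
    Σ (List (Subset n)) (λ cl →
      HasClass K (CSDT K n shape h) cl × ((s : Vec ℕ n) → chB cl s ≡ G n shape s))
theorem4p3 K n shape _ _ h =
  let cl , class , ch = MatrixActions.triangular-hasClass K (N K n shape) (entry K n shape)
                          (Des ∘ tab K n shape) (rank ∘ tab K n shape)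
                          (entry-diagonal K n shape) (entry-triangular K n shape) h
  in cl , class , λ s → ≡.trans (ch s) (≡.sym (sum-map≡Σ-lookup (λ t → FB (Des t) s) (SDT n shape)))
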